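{- Let $a,b,k$ be integers with $k\ge b>a\ge1$. For $m\ge1$ let $\mathcal{BR}_{a,b,k}(m)$ be the set of partitions $\lambda=(\lambda_1,\dots,\lambda_m)$ with exactly $m$ parts, all parts congruent to $a$ or $b$ modulo $k$, only parts congruent to $a$ modulo $k$ repeated, such that $\lambda_m\in\{a,b\}$ and, for $1\le i<m$, $\lambda_i-\lambda_{i+1}\le k$ with strict inequality if $\lambda_{i+1}\equiv a\pmod k$. For $0\le h\le m-1$ let $\mathcal{BR}_{a,b,k}(m,h,a)$ (resp. $\mathcal{BR}_{a,b,k}(m,h,b)$) be the set of $\lambda\in\mathcal{BR}_{a,b,k}(m)$ with largest part $kh+a$ (resp. $kh+b$). Then for $m\ge1$ and $0\le h\le m-1$, \[\sum_{\lambda\in\mathcal{BR}_{a,b,k}(m,h,a)}u^{\ell_a(\lambda)}v^{\ell_b(\lambda)}q^{|\lambda|}=u^{m-h}v^hq^{ma+k\binom{h+1}{2}+(b-a)h}{{m-1}\brack h}_k,\] \[\sum_{\lambda\in\mathcal{BR}_{a,b,k}(m,h,b)}u^{\ell_a(\lambda)}v^{\ell_b(\lambda)}q^{|\lambda|}=u^{m-h-1}v^{h+1}q^{ma+k\binom{h+1}{2}+(b-a)(h+1)}{{m-1}\brack h}_k.\]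
   Context: A partition is a finite non-increasing sequence of positive integers; $|\lambda|$ is the sum of its parts; $\ell_a(\lambda)$, $\ell_b(\lambda)$ are the numbers of parts congruent to $a$, resp. $b$, modulo $k$. $(x;q)_n=\prod_{i=0}^{n-1}(1-xq^i)$, and ${A\brack B}_k=\frac{(q^k;q^k)_A}{(q^k;q^k)_B(q^k;q^k)_{A-B}}$ for $A\ge B\ge0$, $0$ otherwise. -}

module Defs where

open import Data.Nat using (ℕ; zero; suc; _+_; _*_; _∸_; _≡ᵇ_; _≤ᵇ_; _<ᵇ_; NonZero; _%_)
open import Data.Bool using (Bool; true; false; _∧_; _∨_; not; if_then_else_)
open import Data.List using (List; []; _∷_; map; concatMap; filter; foldr; length; upTo)
open import Data.Nat.ListAction using (sum)
open import Level using (Level)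
open import Algebra.Bundles using (CommutativeRing)
open import Relation.Nullary.Decidable using (Dec)
open import Relation.Binary.PropositionalEquality using (_≡_)
open import Data.Bool.Properties using (T?)
open import Data.Bool using (T)

_⇒ᵇ_ : Bool → Bool → Bool
x ⇒ᵇ y = not x ∨ y

module _ (k : ℕ) .{{_ : NonZero k}} where

  congᵇ : ℕ → ℕ → Bool
  congᵇ x y = (x % k) ≡ᵇ (y % k)

  module _ (a b : ℕ) where

    adjOK : ℕ → ℕ → Bool
    adjOK x y = (y ≤ᵇ x)
              ∧ ((x ≡ᵇ y) ⇒ᵇ congᵇ y a)
              ∧ ((x ∸ y) ≤ᵇ k)
              ∧ (congᵇ y a ⇒ᵇ ((x ∸ y) <ᵇ k))

    partOK : ℕ → Bool
    partOK x = (1 ≤ᵇ x) ∧ (congᵇ x a ∨ congᵇ x b)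

    chainOK : List ℕ → Bool
    chainOK [] = false
    chainOK (x ∷ []) = partOK x ∧ ((x ≡ᵇ a) ∨ (x ≡ᵇ b))
    chainOK (x ∷ y ∷ ys) = partOK x ∧ adjOK x y ∧ chainOK (y ∷ ys)

    -- λ ∈ BR_{a,b,k}(m)   (partition written λ_1 ≥ … ≥ λ_m as a list)
    isBR : ℕ → List ℕ → Bool
    isBR m λs = (length λs ≡ᵇ m) ∧ chainOK λs

    ℓ : ℕ → List ℕ → ℕ
    ℓ c [] = 0
    ℓ c (x ∷ xs) = (if congᵇ x c then 1 else 0) + ℓ c xs

largest : List ℕ → ℕ
largest [] = 0
largest (x ∷ _) = x

lists : ℕ → ℕ → List (List ℕ)
lists zero N = [] ∷ []
lists (suc m) N = concatMap (λ x → map (x ∷_) (lists m N)) (map suc (upTo N))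

-- BR_{a,b,k}(m,h,c) for c ∈ {a,b}: members of BR_{a,b,k}(m) with largest
-- part kh + c.  Every such partition has all parts ≤ kh + c, so it occurs
-- (exactly once) in  lists m (k*h+c).
BRset : (k : ℕ) .{{_ : NonZero k}} → ℕ → ℕ → ℕ → ℕ → ℕ → List (List ℕ)
BRset k a b m h c =
  filter (λ λs → T? (isBR k a b m λs ∧ (largest λs ≡ᵇ (k * h + c)))) (lists m (k * h + c))

module Ring {c ℓ' : Level} (R : CommutativeRing c ℓ') where
  open CommutativeRing R public using (Carrier; _≈_; 0#; 1#) renaming (_*_ to _·_; _+_ to _⊕_; _-_ to _⊖_)

  pow : Carrier → ℕ → Carrier
  pow x zero = 1#
  pow x (suc n) = x · pow x n

  poch : Carrier → ℕ → Carrier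
  poch t zero = 1#
  poch t (suc n) = poch t n · (1# ⊖ pow t (suc n))

  genSum : (k : ℕ) .{{_ : NonZero k}} → (a b m h c : ℕ) → Carrier → Carrier → Carrier → Carrier
  genSum k a b m h c u v q =
    foldr (λ λs acc → (pow u (ℓ k a b a λs) · pow v (ℓ k a b b λs) · pow q (sum λs)) ⊕ acc)
          0# (BRset k a b m h c)

{-# OPTIONS --safe #-}
-- Every part of a partition in BR_{a,b,k}(m) is kh + a or kh + b; call h its level.  The
-- adjacency conditions force the part after one of level h to be kh + a or, if h > 0,
-- k(h - 1) + b.  Hence the generating function of the n parts below a part of level h obeys
-- a two-term recursion in (n, h), solved by u^(n-h) v^h q^(na + k C(h,2) + (b-a)h) times the
-- Gaussian binomial [n h] in base q^k (q-Pascal rule), and multiplying that binomial by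
-- (q^k;q^k)_h (q^k;q^k)_(n-h) gives (q^k;q^k)_n.
module Submission where

open import Defs
open import Level using (Level)
open import Algebra.Bundles using (CommutativeRing)
open import Data.Bool using (Bool; true; false; T; _∧_; _∨_; if_then_else_)
open import Data.Bool.Properties using (T?; T-≡; T-∧; T-∨; ⇔→≡; if-∧; if-swap-then)
open import Data.Empty using (⊥; ⊥-elim)
open import Data.List using (List; []; _∷_; _++_; map; concatMap; filter; foldr; length; upTo)
open import Data.List.Membership.Propositional using (_∈_)
open import Data.List.Membership.Propositional.Properties using (∈-map⁺; ∈-upTo⁺)
open import Data.List.Relation.Unary.All as All using (All; []; _∷_)
import Data.List.Relation.Unary.All.Properties as All
open import Data.List.Relation.Unary.Any using (here; there)
open import Data.List.Relation.Unary.Unique.Propositional using (Unique; []; _∷_)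
import Data.List.Relation.Unary.Unique.Propositional.Properties as Unique
open import Data.Nat using (ℕ; zero; suc; _+_; _*_; _∸_; _≤_; _<_; NonZero; _≡ᵇ_; _≤ᵇ_; _<ᵇ_; _%_; _/_; z≤n; s≤s; s≤s⁻¹; _≟_)
open import Data.Nat.Combinatorics using (_C_; nC1≡n; nCk+nC[k+1]≡[n+1]C[k+1])
open import Data.Nat.DivMod using (m≡m%n+[m/n]*n; [m+kn]%n≡m%n; /-monoˡ-≤)
open import Data.Nat.ListAction using (sum)
import Data.Nat.Properties as ℕₚ
open import Data.Nat.Tactic.RingSolver using (solve-∀)
open import Data.Product using (_×_; _,_; proj₁; proj₂; ∃-syntax)
import Data.Product as Product
open import Data.Sum using (_⊎_; inj₁; inj₂)
import Data.Sum as Sum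
open import Data.Unit using (tt)
open import Function using (_∘_; _⇔_; mk⇔; Equivalence)
import Function.Properties.Equivalence as ⇔
open import Relation.Binary.PropositionalEquality as ≡ using (_≡_; _≢_; refl; cong; cong₂; ≢-sym)
open import Relation.Nullary using (yes; no)
open import Relation.Nullary.Decidable using (dec-true; dec-false)

open Equivalence

≡ᵇ-refl : ∀ n → (n ≡ᵇ n) ≡ true
≡ᵇ-refl n = dec-true (n ≟ n) refl

≢⇒≡ᵇ-false : ∀ {m n} → m ≢ n → (m ≡ᵇ n) ≡ false
≢⇒≡ᵇ-false {m} {n} = dec-false (m ≟ n)

T-⇒ᵇ : ∀ {p q} → T (p ⇒ᵇ q) ⇔ (T p → T q)
T-⇒ᵇ {true}  = mk⇔ (λ t _ → t) (λ f → f tt)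
T-⇒ᵇ {false} = mk⇔ (λ _ ()) (λ _ → tt)

T-⇔⇒≡ : ∀ {p q} → (T p ⇔ T q) → p ≡ q
T-⇔⇒≡ p⇔q = ⇔→≡ (⇔.trans (⇔.sym T-≡) (⇔.trans p⇔q T-≡))

module Residues (k : ℕ) .{{_ : NonZero k}} where
  open ℕₚ
  open ≡ using (sym; trans)

  T-congᵇ : ∀ {x y} → T (congᵇ k x y) ⇔ (x % k ≡ y % k)
  T-congᵇ {x} {y} = mk⇔ (≡ᵇ⇒≡ (x % k) (y % k)) (≡⇒≡ᵇ (x % k) (y % k))

  [k*h+r]%k≡r%k : ∀ h r → (k * h + r) % k ≡ r % k
  [k*h+r]%k≡r%k h r =
    trans (cong (_% k) (trans (+-comm (k * h) r) (cong (r +_) (*-comm k h)))) ([m+kn]%n≡m%n r h k)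

  private
    %-≡-≤⇒≡ : ∀ {m n} → m % k ≡ n % k → m ≤ n → n < m + k → m ≡ n
    %-≡-≤⇒≡ {m} {n} eq m≤n n<m+k = begin-equality
        m                  ≡⟨ m≡m%n+[m/n]*n m k ⟩
        m % k + m / k * k  ≡⟨ cong₂ _+_ eq (cong (_* k) quotients) ⟩
        n % k + n / k * k  ≡⟨ m≡m%n+[m/n]*n n k ⟨
        n                  ∎
      where
      open ≤-Reasoning
      upper : n % k + n / k * k < n % k + suc (m / k) * k
      upper = begin-strict
        n % k + n / k * k        ≡⟨ m≡m%n+[m/n]*n n k ⟨
        n                        <⟨ n<m+k ⟩
        m + k                    ≡⟨ cong (_+ k) (m≡m%n+[m/n]*n m k) ⟩
        m % k + m / k * k + k    ≡⟨ cong (λ r → r + m / k * k + k) eq ⟩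
        n % k + m / k * k + k    ≡⟨ +-assoc (n % k) (m / k * k) k ⟩
        n % k + (m / k * k + k)  ≡⟨ cong (n % k +_) (+-comm (m / k * k) k) ⟩
        n % k + suc (m / k) * k  ∎
      quotients : m / k ≡ n / k
      quotients = ≤-antisym (/-monoˡ-≤ k m≤n)
        (s≤s⁻¹ (*-cancelʳ-< k (n / k) (suc (m / k)) (+-cancelˡ-< (n % k) _ _ upper)))

  %-≡⇒≡ : ∀ {m n} → m % k ≡ n % k → m < n + k → n < m + k → m ≡ n
  %-≡⇒≡ {m} {n} eq m<n+k n<m+k with ≤-total m n
  ... | inj₁ m≤n = %-≡-≤⇒≡ eq m≤n n<m+k
  ... | inj₂ n≤m = sym (%-≡-≤⇒≡ (sym eq) n≤m m<n+k)

module Parts (k : ℕ) .{{_ : NonZero k}} (a b : ℕ) (1≤a : 1 ≤ a) (a<b : a < b) (b≤k : b ≤ k) where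
  open ℕₚ
  open ≡ using (sym; trans; subst)
  open Residues k

  a%k≢b%k : a % k ≢ b % k
  a%k≢b%k eq = <⇒≢ a<b (%-≡⇒≡ eq (<-≤-trans a<b (m≤m+n b k)) (≤-<-trans b≤k (m<n+m k 1≤a)))

  -- adjOK x y as a proposition, with the truncated difference x ∸ y eliminated.
  record Adjacent (x y : ℕ) : Set where
    field
      y≤x      : y ≤ x
      repeated : x ≡ y → y % k ≡ a % k
      x≤y+k    : x ≤ y + k
      x<y+k    : y % k ≡ a % k → x < y + k

  adjOK⇔Adjacent : ∀ {x y} → T (adjOK k a b x y) ⇔ Adjacent x y
  adjOK⇔Adjacent {x} {y} = mk⇔ to′ from′
    where
    conjuncts : T (adjOK k a b x y) →
                T (y ≤ᵇ x) × T ((x ≡ᵇ y) ⇒ᵇ congᵇ k y a) × T ((x ∸ y) ≤ᵇ k) × T (congᵇ k y a ⇒ᵇ ((x ∸ y) <ᵇ k))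
    conjuncts = Product.map₂ (Product.map₂ (T-∧ .to) ∘ T-∧ .to) ∘ T-∧ .to
    to′ : T (adjOK k a b x y) → Adjacent x y
    to′ t = let (t₁ , t₂ , t₃ , t₄) = conjuncts t in record
      { y≤x      = ≤ᵇ⇒≤ y x t₁
      ; repeated = T-congᵇ .to ∘ T-⇒ᵇ .to t₂ ∘ ≡⇒≡ᵇ x y
      ; x≤y+k    = ≤-trans (m≤n+m∸n x y) (+-monoʳ-≤ y (≤ᵇ⇒≤ (x ∸ y) k t₃))
      ; x<y+k    = λ ya → ≤-<-trans (m≤n+m∸n x y) (+-monoʳ-< y (<ᵇ⇒< (x ∸ y) k (T-⇒ᵇ .to t₄ (T-congᵇ .from ya))))
      }
    from′ : Adjacent x y → T (adjOK k a b x y)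
    from′ adj = T-∧ .from (≤⇒≤ᵇ y≤x , T-∧ .from
                  ( T-⇒ᵇ .from (T-congᵇ .from ∘ repeated ∘ ≡ᵇ⇒≡ x y)
                  , T-∧ .from ( ≤⇒≤ᵇ (m≤n+o⇒m∸n≤o x y x≤y+k)
                              , T-⇒ᵇ .from (<⇒<ᵇ ∘ m<n+o⇒m∸n<o x y ∘ x<y+k ∘ T-congᵇ .to))))
      where open Adjacent adj

  T-partOK : ∀ {y} → T (partOK k a b y) ⇔ (1 ≤ y × (y % k ≡ a % k ⊎ y % k ≡ b % k))
  T-partOK {y} = mk⇔
    (λ t → ≤ᵇ⇒≤ 1 y (proj₁ (T-∧ .to t)) , Sum.map (T-congᵇ .to) (T-congᵇ .to) (T-∨ .to (proj₂ (T-∧ .to t))))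
    (λ (1≤y , cls) → T-∧ .from (≤⇒≤ᵇ 1≤y , T-∨ .from (Sum.map (T-congᵇ .from) (T-congᵇ .from) cls)))

  a≤c≤b : ∀ {c} → c ≡ a ⊎ c ≡ b → a ≤ c × c ≤ b
  a≤c≤b (inj₁ refl) = ≤-refl , <⇒≤ a<b
  a≤c≤b (inj₂ refl) = <⇒≤ a<b , ≤-refl

  k*[1+h]≡k*h+k : ∀ h → k * suc h ≡ k * h + k
  k*[1+h]≡k*h+k h = trans (*-suc k h) (+-comm k (k * h))

  k*h+c<k*h+a+k : ∀ h {c} → c ≤ b → k * h + c < k * h + a + k
  k*h+c<k*h+a+k h {c} c≤b = begin-strict
    k * h + c        ≤⟨ +-monoʳ-≤ (k * h) (≤-trans c≤b b≤k) ⟩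
    k * h + k        <⟨ +-monoʳ-< (k * h) (m<n+m k 1≤a) ⟩
    k * h + (a + k)  ≡⟨ +-assoc (k * h) a k ⟨
    k * h + a + k    ∎
    where open ≤-Reasoning

  k*h+b<k*[1+h]+c : ∀ h {c} → 1 ≤ c → k * h + b < k * suc h + c
  k*h+b<k*[1+h]+c h {c} 1≤c = begin-strict
    k * h + b      ≤⟨ +-monoʳ-≤ (k * h) b≤k ⟩
    k * h + k      <⟨ m<m+n (k * h + k) 1≤c ⟩
    k * h + k + c  ≡⟨ cong (_+ c) (k*[1+h]≡k*h+k h) ⟨
    k * suc h + c  ∎
    where open ≤-Reasoning

  k*[1+h]+c≤k*h+b+k : ∀ h {c} → c ≤ b → k * suc h + c ≤ k * h + b + k
  k*[1+h]+c≤k*h+b+k h {c} c≤b = begin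
    k * suc h + c    ≡⟨ cong (_+ c) (k*[1+h]≡k*h+k h) ⟩
    k * h + k + c    ≤⟨ +-monoʳ-≤ (k * h + k) c≤b ⟩
    k * h + k + b    ≡⟨ +-assoc (k * h) k b ⟩
    k * h + (k + b)  ≡⟨ cong (k * h +_) (+-comm k b) ⟩
    k * h + (b + k)  ≡⟨ +-assoc (k * h) b k ⟨
    k * h + b + k    ∎
    where open ≤-Reasoning

  Successor : ℕ → ℕ → Set
  Successor h y = y ≡ k * h + a ⊎ ∃[ h′ ] h ≡ suc h′ × y ≡ k * h′ + b

  successor⇒Adjacent : ∀ h {c y} → a ≤ c → c ≤ b → Successor h y → Adjacent (k * h + c) y
  successor⇒Adjacent h a≤c c≤b (inj₁ refl) = record
    { y≤x      = +-monoʳ-≤ (k * h) a≤c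
    ; repeated = λ _ → [k*h+r]%k≡r%k h a
    ; x≤y+k    = <⇒≤ (k*h+c<k*h+a+k h c≤b)
    ; x<y+k    = λ _ → k*h+c<k*h+a+k h c≤b
    }
  successor⇒Adjacent _ a≤c c≤b (inj₂ (h , refl , refl)) = record
    { y≤x      = <⇒≤ y<x
    ; repeated = λ x≡y → ⊥-elim (<⇒≢ y<x (sym x≡y))
    ; x≤y+k    = k*[1+h]+c≤k*h+b+k h c≤b
    ; x<y+k    = λ y≡a → ⊥-elim (a%k≢b%k (trans (sym y≡a) ([k*h+r]%k≡r%k h b)))
    }
    where
    y<x : k * h + b < k * suc h + _
    y<x = k*h+b<k*[1+h]+c h (≤-trans 1≤a a≤c)

  private
    same-level : ∀ h {c y} → a ≤ c → c ≤ b → Adjacent (k * h + c) y → y % k ≡ a % k → y ≡ k * h + a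
    same-level h a≤c c≤b adj y≡a = %-≡⇒≡ (trans y≡a (sym ([k*h+r]%k≡r%k h a)))
      (≤-<-trans y≤x (k*h+c<k*h+a+k h c≤b))
      (≤-<-trans (+-monoʳ-≤ (k * h) a≤c) (x<y+k y≡a))
      where open Adjacent adj

    level-below : ∀ h {c y} → a ≤ c → c ≤ b → 1 ≤ y → y < k * h + c → k * h + c ≤ y + k →
                  y % k ≡ b % k → ∃[ h′ ] h ≡ suc h′ × y ≡ k * h′ + b
    level-below zero {c} {y} _ c≤b 1≤y y<x _ y≡b = ⊥-elim (<⇒≢ y<b
      (%-≡⇒≡ y≡b (<-≤-trans y<b (m≤m+n b k)) (≤-<-trans b≤k (m<n+m k 1≤y))))
      where
      y<b : y < b
      y<b = <-≤-trans (subst (y <_) (cong (_+ c) (*-zeroʳ k)) y<x) c≤b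
    level-below (suc h) a≤c c≤b _ y<x x≤y+k y≡b = h , refl ,
      %-≡⇒≡ (trans y≡b (sym ([k*h+r]%k≡r%k h b)))
        (<-≤-trans y<x (k*[1+h]+c≤k*h+b+k h c≤b))
        (<-≤-trans (k*h+b<k*[1+h]+c h (≤-trans 1≤a a≤c)) x≤y+k)

  adjacent⇒successor : ∀ h {c y} → a ≤ c → c ≤ b → T (partOK k a b y) → Adjacent (k * h + c) y → Successor h y
  adjacent⇒successor h {c} {y} a≤c c≤b py adj with T-partOK .to py
  ... | _   , inj₁ y≡a = inj₁ (same-level h a≤c c≤b adj y≡a)
  ... | 1≤y , inj₂ y≡b = inj₂ (level-below h a≤c c≤b 1≤y y<x x≤y+k y≡b)
    where
    open Adjacent adj
    y<x : y < k * h + c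
    y<x = ≤∧≢⇒< y≤x (λ y≡x → a%k≢b%k (trans (sym (repeated (sym y≡x))) y≡b))

  descentᵇ : ℕ → ℕ → Bool
  descentᵇ zero    _ = false
  descentᵇ (suc h) y = y ≡ᵇ k * h + b

  T-successor : ∀ h {y} → T ((y ≡ᵇ k * h + a) ∨ descentᵇ h y) ⇔ Successor h y
  T-successor h {y} = mk⇔
    (Sum.map (≡ᵇ⇒≡ y _) (descent h) ∘ T-∨ .to)
    (T-∨ .from ∘ Sum.map (≡⇒≡ᵇ y _) (descent⁻¹ h))
    where
    descent : ∀ h → T (descentᵇ h y) → ∃[ h′ ] h ≡ suc h′ × y ≡ k * h′ + b
    descent (suc h) t = h , refl , ≡ᵇ⇒≡ y _ t
    descent⁻¹ : ∀ h → ∃[ h′ ] h ≡ suc h′ × y ≡ k * h′ + b → T (descentᵇ h y)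
    descent⁻¹ _ (h , refl , y≡) = ≡⇒≡ᵇ y _ y≡

  adjOK-level : ∀ h {c y} → a ≤ c → c ≤ b → T (partOK k a b y) →
                adjOK k a b (k * h + c) y ≡ (y ≡ᵇ k * h + a) ∨ descentᵇ h y
  adjOK-level h a≤c c≤b py = T-⇔⇒≡ (mk⇔
    (T-successor h .from ∘ adjacent⇒successor h a≤c c≤b py ∘ adjOK⇔Adjacent .to)
    (adjOK⇔Adjacent .from ∘ successor⇒Adjacent h a≤c c≤b ∘ T-successor h .to))

  successors-distinct : ∀ h {y} → T (y ≡ᵇ k * h + a) → T (descentᵇ h y) → ⊥
  successors-distinct (suc h) {y} y≡ᵇ y≡ᵇ′ =
    <⇒≢ (k*h+b<k*[1+h]+c h 1≤a) (trans (sym (≡ᵇ⇒≡ y _ y≡ᵇ′)) (≡ᵇ⇒≡ y _ y≡ᵇ))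

  partOK-level : ∀ h {c} → c ≡ a ⊎ c ≡ b → T (partOK k a b (k * h + c))
  partOK-level h {c} c∈ab = T-partOK .from
    ( ≤-trans (≤-trans 1≤a (proj₁ (a≤c≤b c∈ab))) (m≤n+m c (k * h))
    , Sum.map (class a) (class b) c∈ab )
    where
    class : ∀ r → c ≡ r → (k * h + c) % k ≡ r % k
    class r refl = [k*h+r]%k≡r%k h r

  chainOK-singleton : ∀ h {c} → c ≡ a ⊎ c ≡ b → chainOK k a b (k * h + c ∷ []) ≡ (h ≡ᵇ 0)
  chainOK-singleton h {c} c∈ab = T-⇔⇒≡ (mk⇔ to′ from′)
    where
    x : ℕ
    x = k * h + c
    1≤c : 1 ≤ c
    1≤c = ≤-trans 1≤a (proj₁ (a≤c≤b c∈ab))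
    level-zero : ∀ h → k * h + c ≤ b → h ≡ 0
    level-zero zero    _ = refl
    level-zero (suc h) x≤b = ⊥-elim (<-irrefl refl (begin-strict
      b              ≤⟨ ≤-trans b≤k (m≤m*n k (suc h)) ⟩
      k * suc h      <⟨ m<m+n (k * suc h) 1≤c ⟩
      k * suc h + c  ≤⟨ x≤b ⟩
      b              ∎))
      where open ≤-Reasoning
    to′ : T (chainOK k a b (x ∷ [])) → T (h ≡ᵇ 0)
    to′ t = ≡⇒≡ᵇ h 0 (level-zero h (Sum.[ (λ x≡a → ≤-trans (≤-reflexive x≡a) (<⇒≤ a<b)) , ≤-reflexive ]
              (Sum.map (≡ᵇ⇒≡ x a) (≡ᵇ⇒≡ x b) (T-∨ .to (proj₂ (T-∧ .to t))))))
    from′ : T (h ≡ᵇ 0) → T (chainOK k a b (x ∷ []))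
    from′ t = T-∧ .from (partOK-level h c∈ab , T-∨ .from (Sum.map (is a) (is b) c∈ab))
      where
      x≡c : x ≡ c
      x≡c = cong (_+ c) (trans (cong (k *_) (≡ᵇ⇒≡ h 0 t)) (*-zeroʳ k))
      is : ∀ r → c ≡ r → T (x ≡ᵇ r)
      is r c≡r = ≡⇒≡ᵇ x r (trans x≡c c≡r)

  chainOK-invalid-head : ∀ {y} l → partOK k a b y ≡ false → chainOK k a b (y ∷ l) ≡ false
  chainOK-invalid-head []      invalid rewrite invalid = refl
  chainOK-invalid-head (_ ∷ _) invalid rewrite invalid = refl

  congᵇ-level : ∀ h r s → congᵇ k (k * h + r) s ≡ congᵇ k r s
  congᵇ-level h r s = cong (_≡ᵇ s % k) ([k*h+r]%k≡r%k h r)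

  levelExponent : ℕ → ℕ → ℕ
  levelExponent n h = n * a + k * (h C 2) + (b ∸ a) * h

  private
    [1+h]C2≡h+hC2 : ∀ h → suc h C 2 ≡ h + h C 2
    [1+h]C2≡h+hC2 h = trans (sym (nCk+nC[k+1]≡[n+1]C[k+1] h 1)) (cong (_+ h C 2) (nC1≡n h))

  levelExponent-0-0 : levelExponent 0 0 ≡ 0
  levelExponent-0-0 = cong₂ _+_ (*-zeroʳ k) (*-zeroʳ (b ∸ a))

  exponent-stay : ∀ n h → k * h + a + levelExponent n h ≡ levelExponent (suc n) h + k * h
  exponent-stay n h = polynomial k a n (b ∸ a) h (h C 2)
    where
    polynomial : ∀ k a n d h C → k * h + a + (n * a + k * C + d * h) ≡ a + n * a + k * C + d * h + k * h
    polynomial = solve-∀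

  exponent-descent : ∀ n h → k * h + b + levelExponent n h ≡ levelExponent (suc n) (suc h)
  exponent-descent n h = begin-equality
    k * h + b + levelExponent n h                      ≡⟨ cong (λ b′ → k * h + b′ + levelExponent n h) (m+[n∸m]≡n (<⇒≤ a<b)) ⟨
    k * h + (a + d) + (n * a + k * (h C 2) + d * h)    ≡⟨ polynomial k a n d h (h C 2) ⟩
    a + n * a + k * (h + h C 2) + d * suc h            ≡⟨ cong (λ C → a + n * a + k * C + d * suc h) ([1+h]C2≡h+hC2 h) ⟨
    levelExponent (suc n) (suc h)                      ∎
    where
    open ≤-Reasoning
    d : ℕ
    d = b ∸ a
    polynomial : ∀ k a n d h C → k * h + (a + d) + (n * a + k * C + d * h) ≡ a + n * a + k * (h + C) + d * suc h
    polynomial = solve-∀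

  exponent-top : ∀ n h → levelExponent (suc n) h + k * h ≡ suc n * a + k * (suc h C 2) + (b ∸ a) * h
  exponent-top n h = trans (polynomial k a n (b ∸ a) h (h C 2))
                           (cong (λ C → suc n * a + k * C + (b ∸ a) * h) (sym ([1+h]C2≡h+hC2 h)))
    where
    polynomial : ∀ k a n d h C → a + n * a + k * C + d * h + k * h ≡ a + n * a + k * (h + C) + d * h
    polynomial = solve-∀

oneTo : ℕ → List ℕ
oneTo N = map suc (upTo N)

oneTo-unique : ∀ N → Unique (oneTo N)
oneTo-unique N = Unique.map⁺ ℕₚ.suc-injective (Unique.upTo⁺ N)

∈-oneTo : ∀ {N j} → 1 ≤ j → j ≤ N → j ∈ oneTo N
∈-oneTo (s≤s _) j≤N = ∈-map⁺ suc (∈-upTo⁺ j≤N)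

lists-length : ∀ n N → All (λ l → length l ≡ n) (lists n N)
lists-length zero    N = refl ∷ []
lists-length (suc n) N = All.concat⁺ (All.map⁺ {xs = oneTo N} (All.tabulate λ {y} _ → prepend y))
  where
  prepend : ∀ y → All (λ l → length l ≡ suc n) (map (y ∷_) (lists n N))
  prepend y = All.map⁺ (All.map (cong suc) (lists-length n N))

module RingLemmas {c ℓ′ : Level} (R : CommutativeRing c ℓ′) where
  open Ring R public
  open CommutativeRing R public
    using ( +-cong; +-congˡ; +-congʳ; +-assoc; +-comm; +-identityˡ; +-identityʳ; -‿inverseˡ
          ; *-cong; *-congˡ; *-congʳ; *-assoc; *-comm; *-identityˡ; *-identityʳ; zeroˡ; zeroʳ
          ; distribˡ; distribʳ; setoid; semiring; *-commutativeSemigroup; ring; -‿inverseʳ; -‿cong )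
    renaming (refl to ≈-refl; sym to ≈-sym; trans to ≈-trans; reflexive to ≈-reflexive; -_ to ⊝_)
  open import Algebra.Properties.Ring ring using (x[y-z]≈xy-xz)
  open import Algebra.Properties.CommutativeSemigroup (CommutativeRing.+-commutativeSemigroup R)
    using () renaming (interchange to +-interchange)
  open import Algebra.Properties.CommutativeSemigroup *-commutativeSemigroup
    using (x∙yz≈y∙xz; xy∙z≈xz∙y) renaming (interchange to *-interchange)
  open import Algebra.Properties.Semiring.Exp semiring using (_^_; ^-homo-*; ^-assocʳ)
  open import Relation.Binary.Reasoning.Setoid setoid

  ∑ : {A : Set} → List A → (A → Carrier) → Carrier
  ∑ []       f = 0#
  ∑ (x ∷ xs) f = f x ⊕ ∑ xs f

  syntax ∑ L (λ x → e) = ∑[ x ∈ L ] e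

  ∑-cong : ∀ {A : Set} (L : List A) {f g : A → Carrier} → (∀ x → f x ≈ g x) → ∑ L f ≈ ∑ L g
  ∑-cong []      _   = ≈-refl
  ∑-cong (x ∷ L) f≈g = +-cong (f≈g x) (∑-cong L f≈g)

  ∑-congᴬ : ∀ {A : Set} {L : List A} {f g : A → Carrier} → All (λ x → f x ≈ g x) L → ∑ L f ≈ ∑ L g
  ∑-congᴬ []           = ≈-refl
  ∑-congᴬ (fx≈gx ∷ ps) = +-cong fx≈gx (∑-congᴬ ps)

  ∑-zero : ∀ {A : Set} (L : List A) → ∑[ _ ∈ L ] 0# ≈ 0#
  ∑-zero []      = ≈-refl
  ∑-zero (_ ∷ L) = ≈-trans (+-identityˡ _) (∑-zero L)

  ∑-+ : ∀ {A : Set} (L : List A) (f g : A → Carrier) → ∑[ x ∈ L ] (f x ⊕ g x) ≈ ∑ L f ⊕ ∑ L g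
  ∑-+ []      _ _ = ≈-sym (+-identityˡ 0#)
  ∑-+ (x ∷ L) f g = begin
    (f x ⊕ g x) ⊕ ∑[ y ∈ L ] (f y ⊕ g y)  ≈⟨ +-congˡ (∑-+ L f g) ⟩
    (f x ⊕ g x) ⊕ (∑ L f ⊕ ∑ L g)         ≈⟨ +-interchange (f x) (g x) (∑ L f) (∑ L g) ⟩
    (f x ⊕ ∑ L f) ⊕ (g x ⊕ ∑ L g)         ∎

  ∑-*ˡ : ∀ {A : Set} (L : List A) (z : Carrier) (f : A → Carrier) → ∑[ x ∈ L ] (z · f x) ≈ z · ∑ L f
  ∑-*ˡ []      z _ = ≈-sym (zeroʳ z)
  ∑-*ˡ (x ∷ L) z f = ≈-trans (+-congˡ (∑-*ˡ L z f)) (≈-sym (distribˡ z (f x) (∑ L f)))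

  ∑-++ : ∀ {A : Set} (xs ys : List A) (f : A → Carrier) → ∑ (xs ++ ys) f ≈ ∑ xs f ⊕ ∑ ys f
  ∑-++ []       ys f = ≈-sym (+-identityˡ _)
  ∑-++ (x ∷ xs) ys f = ≈-trans (+-congˡ (∑-++ xs ys f)) (≈-sym (+-assoc _ _ _))

  ∑-concatMap : ∀ {A B : Set} (F : A → List B) (xs : List A) (f : B → Carrier) →
                ∑ (concatMap F xs) f ≈ ∑[ x ∈ xs ] ∑ (F x) f
  ∑-concatMap F []       f = ≈-refl
  ∑-concatMap F (x ∷ xs) f = ≈-trans (∑-++ (F x) (concatMap F xs) f) (+-congˡ (∑-concatMap F xs f))

  ∑-map : ∀ {A B : Set} (g : A → B) (xs : List A) (f : B → Carrier) → ∑ (map g xs) f ≈ ∑[ x ∈ xs ] f (g x)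
  ∑-map g []       f = ≈-refl
  ∑-map g (x ∷ xs) f = +-congˡ (∑-map g xs f)

  ∑-filter : ∀ {A : Set} (p : A → Bool) (L : List A) (f : A → Carrier) →
             ∑ (filter (λ x → T? (p x)) L) f ≈ ∑[ x ∈ L ] (if p x then f x else 0#)
  ∑-filter p []      f = ≈-refl
  ∑-filter p (x ∷ L) f with p x
  ... | true  = +-congˡ (∑-filter p L f)
  ... | false = ≈-trans (∑-filter p L f) (≈-sym (+-identityˡ _))

  foldr≡∑ : ∀ {A : Set} (f : A → Carrier) (L : List A) → foldr (λ x acc → f x ⊕ acc) 0# L ≡ ∑ L f
  foldr≡∑ f []      = refl
  foldr≡∑ f (x ∷ L) = cong (f x ⊕_) (foldr≡∑ f L)

  ∑-δ : ∀ {L j} (F : ℕ → Carrier) → Unique L → j ∈ L → ∑[ y ∈ L ] (if y ≡ᵇ j then F y else 0#) ≈ F j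
  ∑-δ {x ∷ L} F (x≢L ∷ _) (here refl) rewrite ≡ᵇ-refl x = begin
    F x ⊕ ∑[ y ∈ L ] (if y ≡ᵇ x then F y else 0#)  ≈⟨ +-congˡ (∑-congᴬ (All.map others x≢L)) ⟩
    F x ⊕ ∑[ _ ∈ L ] 0#                             ≈⟨ +-congˡ (∑-zero L) ⟩
    F x ⊕ 0#                                        ≈⟨ +-identityʳ (F x) ⟩
    F x                                             ∎
    where
    others : ∀ {y} → x ≢ y → (if y ≡ᵇ x then F y else 0#) ≈ 0#
    others x≢y rewrite ≢⇒≡ᵇ-false (≢-sym x≢y) = ≈-refl
  ∑-δ {x ∷ L} {j} F (x≢L ∷ L-unique) (there j∈L) rewrite ≢⇒≡ᵇ-false (All.lookup x≢L j∈L) =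
    ≈-trans (+-identityˡ _) (∑-δ F L-unique j∈L)

  ∑-δ-oneTo : ∀ {N j} (F : ℕ → Carrier) → 1 ≤ j → j ≤ N →
              ∑[ y ∈ oneTo N ] (if y ≡ᵇ j then F y else 0#) ≈ F j
  ∑-δ-oneTo {N} F 1≤j j≤N = ∑-δ F (oneTo-unique N) (∈-oneTo 1≤j j≤N)

  ∑-lists-suc : ∀ n N (f : List ℕ → Carrier) →
                ∑ (lists (suc n) N) f ≈ ∑[ y ∈ oneTo N ] ∑[ l ∈ lists n N ] f (y ∷ l)
  ∑-lists-suc n N f =
    ≈-trans (∑-concatMap _ (oneTo N) f) (∑-cong (oneTo N) (λ y → ∑-map (y ∷_) (lists n N) f))

  if-cong : ∀ β {x y} → x ≈ y → (if β then x else 0#) ≈ (if β then y else 0#)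
  if-cong true  x≈y = x≈y
  if-cong false _   = ≈-refl

  if-zero : ∀ β {x} → x ≈ 0# → (if β then x else 0#) ≈ 0#
  if-zero true  x≈0 = x≈0
  if-zero false _   = ≈-refl

  if-*ˡ : ∀ β z x → (if β then z · x else 0#) ≈ z · (if β then x else 0#)
  if-*ˡ true  z x = ≈-refl
  if-*ˡ false z x = ≈-sym (zeroʳ z)

  if-∨ : ∀ β γ {x} → (T β → T γ → ⊥) →
         (if β ∨ γ then x else 0#) ≈ (if β then x else 0#) ⊕ (if γ then x else 0#)
  if-∨ true  true  disjoint = ⊥-elim (disjoint tt tt)
  if-∨ true  false _        = ≈-sym (+-identityʳ _)
  if-∨ false true  _        = ≈-sym (+-identityˡ _)
  if-∨ false false _        = ≈-sym (+-identityˡ 0#)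

  ∑-if : ∀ {A : Set} β (L : List A) (f : A → Carrier) →
         ∑[ x ∈ L ] (if β then f x else 0#) ≈ (if β then ∑ L f else 0#)
  ∑-if true  L f = ≈-refl
  ∑-if false L f = ∑-zero L

  1-x+x[1-y]≈1-xy : ∀ x y → (1# ⊖ x) ⊕ x · (1# ⊖ y) ≈ 1# ⊖ x · y
  1-x+x[1-y]≈1-xy x y = begin
    (1# ⊖ x) ⊕ x · (1# ⊖ y)      ≈⟨ +-congˡ (≈-trans (x[y-z]≈xy-xz x 1# y) (+-congʳ (*-identityʳ x))) ⟩
    (1# ⊖ x) ⊕ (x ⊖ x · y)       ≈⟨ +-assoc 1# (⊝ x) (x ⊖ x · y) ⟩
    1# ⊕ (⊝ x ⊕ (x ⊖ x · y))     ≈⟨ +-congˡ (+-assoc (⊝ x) x (⊝ (x · y))) ⟨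
    1# ⊕ ((⊝ x ⊕ x) ⊖ x · y)     ≈⟨ +-congˡ (+-congʳ (-‿inverseˡ x)) ⟩
    1# ⊕ (0# ⊖ x · y)            ≈⟨ +-congˡ (+-identityˡ _) ⟩
    1# ⊖ x · y                   ∎

  xy≈w⇒x·yz≈w·z : ∀ {x y w z} → x · y ≈ w → x · (y · z) ≈ w · z
  xy≈w⇒x·yz≈w·z xy≈w = ≈-trans (≈-sym (*-assoc _ _ _)) (*-congʳ xy≈w)

  pow≡^ : ∀ x n → pow x n ≡ x ^ n
  pow≡^ x zero    = refl
  pow≡^ x (suc n) = cong (x ·_) (pow≡^ x n)

  pow-+ : ∀ x m n → pow x (m + n) ≈ pow x m · pow x n
  pow-+ x m n rewrite pow≡^ x (m + n) | pow≡^ x m | pow≡^ x n = ^-homo-* x m n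

  pow-* : ∀ x m n → pow (pow x m) n ≈ pow x (m * n)
  pow-* x m n rewrite pow≡^ (pow x m) n | pow≡^ x m | pow≡^ x (m * n) = ^-assocʳ x m n

  module Monomials (u v q : Carrier) where

    monomial : ℕ → ℕ → ℕ → Carrier
    monomial i j e = pow u i · pow v j · pow q e

    monomial-* : ∀ i j e i′ j′ e′ →
                 monomial i j e · monomial i′ j′ e′ ≈ monomial (i + i′) (j + j′) (e + e′)
    monomial-* i j e i′ j′ e′ = begin
      pow u i · pow v j · pow q e · (pow u i′ · pow v j′ · pow q e′)
        ≈⟨ *-interchange _ _ _ _ ⟩
      pow u i · pow v j · (pow u i′ · pow v j′) · (pow q e · pow q e′)
        ≈⟨ *-congʳ (*-interchange _ _ _ _) ⟩
      pow u i · pow u i′ · (pow v j · pow v j′) · (pow q e · pow q e′)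
        ≈⟨ *-cong (*-cong (pow-+ u i i′) (pow-+ v j j′)) (pow-+ q e e′) ⟨
      monomial (i + i′) (j + j′) (e + e′)
        ∎

    monomial-*-pow : ∀ i j e f → monomial i j e · pow q f ≈ monomial i j (e + f)
    monomial-*-pow i j e f = ≈-trans (*-assoc _ _ _) (*-congˡ (≈-sym (pow-+ q e f)))

  module Gaussian (t : Carrier) where

    gaussian : ℕ → ℕ → Carrier
    gaussian zero    zero    = 1#
    gaussian zero    (suc _) = 0#
    gaussian (suc _) zero    = 1#
    gaussian (suc n) (suc h) = gaussian n h ⊕ pow t (suc h) · gaussian n (suc h)

    gaussian-n-0 : ∀ n → gaussian n 0 ≡ 1#
    gaussian-n-0 zero    = refl
    gaussian-n-0 (suc _) = refl

    gaussian-vanishes : ∀ {n h} → n < h → gaussian n h ≈ 0#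
    gaussian-vanishes {zero}  {suc h} _         = ≈-refl
    gaussian-vanishes {suc n} {suc h} (s≤s n<h) = begin
      gaussian n h ⊕ pow t (suc h) · gaussian n (suc h)
        ≈⟨ +-cong (gaussian-vanishes n<h) (*-congˡ (gaussian-vanishes (ℕₚ.m<n⇒m<1+n n<h))) ⟩
      0# ⊕ pow t (suc h) · 0#  ≈⟨ +-identityˡ _ ⟩
      pow t (suc h) · 0#       ≈⟨ zeroʳ _ ⟩
      0#                       ∎

    gaussian-poch : ∀ {n h} → h ≤ n → gaussian n h · poch t h · poch t (n ∸ h) ≈ poch t n
    gaussian-poch {zero}  {zero} _ = ≈-trans (*-identityʳ _) (*-identityʳ _)
    gaussian-poch {suc n} {zero} _ = ≈-trans (*-congʳ (*-identityʳ 1#)) (*-identityˡ _)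
    gaussian-poch {suc n} {suc h} (s≤s h≤n) = begin
      (gaussian n h ⊕ θ · gaussian n (suc h)) · (poch t h · (1# ⊖ θ)) · poch t (n ∸ h)
        ≈⟨ ≈-trans (*-congʳ (distribʳ _ _ _)) (distribʳ _ _ _) ⟩
      gaussian n h · (poch t h · (1# ⊖ θ)) · poch t (n ∸ h) ⊕ θ · gaussian n (suc h) · poch t (suc h) · poch t (n ∸ h)
        ≈⟨ +-cong lower upper ⟩
      poch t n · (1# ⊖ θ) ⊕ θ · (poch t n · (1# ⊖ ω))
        ≈⟨ +-congˡ (x∙yz≈y∙xz θ (poch t n) (1# ⊖ ω)) ⟩
      poch t n · (1# ⊖ θ) ⊕ poch t n · (θ · (1# ⊖ ω))
        ≈⟨ distribˡ (poch t n) _ _ ⟨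
      poch t n · ((1# ⊖ θ) ⊕ θ · (1# ⊖ ω))
        ≈⟨ *-congˡ (1-x+x[1-y]≈1-xy θ ω) ⟩
      poch t n · (1# ⊖ θ · ω)
        ≈⟨ *-congˡ (+-congˡ (-‿cong θω≈t^[1+n])) ⟩
      poch t (suc n)
        ∎
      where
      θ ω : Carrier
      θ = pow t (suc h)
      ω = pow t (n ∸ h)
      θω≈t^[1+n] : θ · ω ≈ pow t (suc n)
      θω≈t^[1+n] = ≈-trans (≈-sym (pow-+ t (suc h) (n ∸ h))) (≈-reflexive (cong (pow t ∘ suc) (ℕₚ.m+[n∸m]≡n h≤n)))
      lower : gaussian n h · (poch t h · (1# ⊖ θ)) · poch t (n ∸ h) ≈ poch t n · (1# ⊖ θ)
      lower = begin
        gaussian n h · (poch t h · (1# ⊖ θ)) · poch t (n ∸ h)  ≈⟨ *-congʳ (*-assoc _ _ _) ⟨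
        gaussian n h · poch t h · (1# ⊖ θ) · poch t (n ∸ h)    ≈⟨ xy∙z≈xz∙y _ _ _ ⟩
        gaussian n h · poch t h · poch t (n ∸ h) · (1# ⊖ θ)    ≈⟨ *-congʳ (gaussian-poch h≤n) ⟩
        poch t n · (1# ⊖ θ)                                    ∎
      shifted : ∀ {i} → i ≤ n → gaussian n (suc i) · poch t (suc i) · poch t (n ∸ i) ≈ poch t n · (1# ⊖ pow t (n ∸ i))
      shifted {i} i≤n with ℕₚ.m≤n⇒m<n∨m≡n i≤n
      ... | inj₁ i<n rewrite ℕₚ.+-∸-assoc 1 i<n =
        ≈-trans (≈-sym (*-assoc _ _ _)) (*-congʳ (gaussian-poch i<n))
      ... | inj₂ refl rewrite ℕₚ.n∸n≡0 i = begin
        gaussian i (suc i) · poch t (suc i) · 1#  ≈⟨ *-identityʳ _ ⟩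
        gaussian i (suc i) · poch t (suc i)       ≈⟨ *-congʳ (gaussian-vanishes (ℕₚ.n<1+n i)) ⟩
        0# · poch t (suc i)                       ≈⟨ zeroˡ _ ⟩
        0#                                        ≈⟨ zeroʳ _ ⟨
        poch t i · 0#                             ≈⟨ *-congˡ (-‿inverseʳ 1#) ⟨
        poch t i · (1# ⊖ 1#)                      ∎
      upper : θ · gaussian n (suc h) · poch t (suc h) · poch t (n ∸ h) ≈ θ · (poch t n · (1# ⊖ ω))
      upper = ≈-trans (≈-trans (*-congʳ (*-assoc _ _ _)) (*-assoc _ _ _)) (*-congˡ (shifted h≤n))

    *-gaussian-poch : ∀ {n h} → h ≤ n → ∀ x → x · gaussian n h · poch t h · poch t (n ∸ h) ≈ x · poch t n
    *-gaussian-poch h≤n x =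
      ≈-trans (≈-trans (*-congʳ (*-assoc _ _ _)) (*-assoc _ _ _)) (*-congˡ (gaussian-poch h≤n))

module Generating {c ℓ′ : Level} (R : CommutativeRing c ℓ′)
                  (k : ℕ) .{{_ : NonZero k}} (a b : ℕ) (1≤a : 1 ≤ a) (a<b : a < b) (b≤k : b ≤ k)
                  (u v q : CommutativeRing.Carrier R) where
  open RingLemmas R
  open Monomials u v q
  open Gaussian (pow q k)
  open Parts k a b 1≤a a<b b≤k
  open import Relation.Binary.Reasoning.Setoid setoid

  weight : List ℕ → Carrier
  weight λs = monomial (ℓ k a b a λs) (ℓ k a b b λs) (sum λs)

  partWeight : ℕ → Carrier
  partWeight y = monomial (if congᵇ k y a then 1 else 0) (if congᵇ k y b then 1 else 0) y

  weight-∷ : ∀ y l → weight (y ∷ l) ≈ partWeight y · weight l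
  weight-∷ y l = ≈-sym (monomial-* (if congᵇ k y a then 1 else 0) (if congᵇ k y b then 1 else 0) y
                                   (ℓ k a b a l) (ℓ k a b b l) (sum l))

  partWeight-a : ∀ h → partWeight (k * h + a) ≈ monomial 1 0 (k * h + a)
  partWeight-a h rewrite congᵇ-level h a a | congᵇ-level h a b | ≡ᵇ-refl (a % k) | ≢⇒≡ᵇ-false a%k≢b%k = ≈-refl

  partWeight-b : ∀ h → partWeight (k * h + b) ≈ monomial 0 1 (k * h + b)
  partWeight-b h rewrite congᵇ-level h b a | congᵇ-level h b b | ≡ᵇ-refl (b % k) | ≢⇒≡ᵇ-false (≢-sym a%k≢b%k) = ≈-refl

  stay-monomial : ∀ {n h} → h ≤ n →
    monomial 1 0 (k * h + a) · monomial (n ∸ h) h (levelExponent n h)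
      ≈ monomial (suc n ∸ h) h (levelExponent (suc n) h) · pow q (k * h)
  stay-monomial {n} {h} h≤n = begin
    monomial 1 0 (k * h + a) · monomial (n ∸ h) h (levelExponent n h)
      ≈⟨ monomial-* 1 0 (k * h + a) (n ∸ h) h (levelExponent n h) ⟩
    monomial (1 + (n ∸ h)) h (k * h + a + levelExponent n h)
      ≈⟨ ≈-reflexive (cong₂ (λ i e → monomial i h e) (≡.sym (ℕₚ.+-∸-assoc 1 h≤n)) (exponent-stay n h)) ⟩
    monomial (suc n ∸ h) h (levelExponent (suc n) h + k * h)
      ≈⟨ monomial-*-pow (suc n ∸ h) h (levelExponent (suc n) h) (k * h) ⟨
    monomial (suc n ∸ h) h (levelExponent (suc n) h) · pow q (k * h)
      ∎

  descent-monomial : ∀ n h →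
    monomial 0 1 (k * h + b) · monomial (n ∸ h) h (levelExponent n h)
      ≈ monomial (n ∸ h) (suc h) (levelExponent (suc n) (suc h))
  descent-monomial n h = ≈-trans (monomial-* 0 1 (k * h + b) (n ∸ h) h (levelExponent n h))
                                 (≈-reflexive (cong (monomial (n ∸ h) (suc h)) (exponent-descent n h)))

  adjOK-split : ∀ h {c} → a ≤ c → c ≤ b → (F : ℕ → Carrier) → (∀ {y} → partOK k a b y ≡ false → F y ≈ 0#) →
                ∀ y → (if adjOK k a b (k * h + c) y then F y else 0#)
                      ≈ (if y ≡ᵇ k * h + a then F y else 0#) ⊕ (if descentᵇ h y then F y else 0#)
  adjOK-split h {c} a≤c c≤b F F-invalid y with T? (partOK k a b y)
  ... | yes valid rewrite adjOK-level h a≤c c≤b valid = if-∨ (y ≡ᵇ k * h + a) (descentᵇ h y) (successors-distinct h)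
  ... | no invalid = begin
    (if adjOK k a b (k * h + c) y then F y else 0#)  ≈⟨ if-zero (adjOK k a b (k * h + c) y) F≈0 ⟩
    0#                                               ≈⟨ +-identityˡ 0# ⟨
    0# ⊕ 0#                                          ≈⟨ +-cong (if-zero (y ≡ᵇ k * h + a) F≈0) (if-zero (descentᵇ h y) F≈0) ⟨
    (if y ≡ᵇ k * h + a then F y else 0#) ⊕ (if descentᵇ h y then F y else 0#) ∎
    where
    F≈0 : F y ≈ 0#
    F≈0 = F-invalid (dec-false (T? _) invalid)

  tailGF : ℕ → ℕ → ℕ → Carrier
  tailGF N n x = ∑[ l ∈ lists n N ] (if chainOK k a b (x ∷ l) then weight l else 0#)

  tailGF-invalid : ∀ N n {y} → partOK k a b y ≡ false → tailGF N n y ≈ 0#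
  tailGF-invalid N n {y} invalid = ≈-trans (∑-cong (lists n N) vanishes) (∑-zero (lists n N))
    where
    vanishes : ∀ l → (if chainOK k a b (y ∷ l) then weight l else 0#) ≈ 0#
    vanishes l rewrite chainOK-invalid-head l invalid = ≈-refl

  tailGF-suc : ∀ N n {x} → T (partOK k a b x) →
               tailGF N (suc n) x ≈ ∑[ y ∈ oneTo N ] (if adjOK k a b x y then partWeight y · tailGF N n y else 0#)
  tailGF-suc N n {x} valid = ≈-trans (∑-lists-suc n N _) (∑-cong (oneTo N) below)
    where
    below : ∀ y → ∑[ l ∈ lists n N ] (if chainOK k a b (x ∷ y ∷ l) then weight (y ∷ l) else 0#)
                ≈ (if adjOK k a b x y then partWeight y · tailGF N n y else 0#)
    below y rewrite T-≡ .to valid with adjOK k a b x y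
    ... | false = ∑-zero (lists n N)
    ... | true  = ≈-trans (∑-cong (lists n N) factor) (∑-*ˡ (lists n N) (partWeight y) _)
      where
      factor : ∀ l → (if chainOK k a b (y ∷ l) then weight (y ∷ l) else 0#)
                   ≈ partWeight y · (if chainOK k a b (y ∷ l) then weight l else 0#)
      factor l = ≈-trans (if-cong (chainOK k a b (y ∷ l)) (weight-∷ y l)) (if-*ˡ (chainOK k a b (y ∷ l)) _ _)

  -- levelGF n h is the weight of the n parts that follow a part of level h (kh + a or kh + b);
  -- descentGF n h is its share in which the first of them is k(h - 1) + b.
  levelGF   : ℕ → ℕ → Carrier
  descentGF : ℕ → ℕ → Carrier

  levelGF zero    zero    = 1#
  levelGF zero    (suc _) = 0#
  levelGF (suc n) h       = monomial 1 0 (k * h + a) · levelGF n h ⊕ descentGF n h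

  descentGF _ zero    = 0#
  descentGF n (suc h) = monomial 0 1 (k * h + b) · levelGF n h

  tailGF-level : ∀ {N} n h {c} → c ≡ a ⊎ c ≡ b → k * h + c ≤ N → tailGF N n (k * h + c) ≈ levelGF n h
  tailGF-level {N} zero h {c} c∈ab _ = begin
    (if chainOK k a b (k * h + c ∷ []) then weight [] else 0#) ⊕ 0#
      ≡⟨ cong (λ β → (if β then weight [] else 0#) ⊕ 0#) (chainOK-singleton h c∈ab) ⟩
    (if h ≡ᵇ 0 then weight [] else 0#) ⊕ 0#
      ≈⟨ bottom h ⟩
    levelGF 0 h
      ∎
    where
    bottom : ∀ h → (if h ≡ᵇ 0 then weight [] else 0#) ⊕ 0# ≈ levelGF 0 h
    bottom zero    = ≈-trans (+-identityʳ _) (≈-trans (*-identityʳ _) (*-identityʳ 1#))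
    bottom (suc _) = +-identityʳ 0#
  tailGF-level {N} (suc n) h {c} c∈ab x≤N = begin
    tailGF N (suc n) (k * h + c)
      ≈⟨ tailGF-suc N n (partOK-level h c∈ab) ⟩
    ∑[ y ∈ oneTo N ] (if adjOK k a b (k * h + c) y then F y else 0#)
      ≈⟨ ∑-cong (oneTo N) (adjOK-split h a≤c c≤b F F-invalid) ⟩
    ∑[ y ∈ oneTo N ] ((if y ≡ᵇ k * h + a then F y else 0#) ⊕ (if descentᵇ h y then F y else 0#))
      ≈⟨ ∑-+ (oneTo N) _ _ ⟩
    ∑[ y ∈ oneTo N ] (if y ≡ᵇ k * h + a then F y else 0#) ⊕ ∑[ y ∈ oneTo N ] (if descentᵇ h y then F y else 0#)
      ≈⟨ +-cong (∑-δ-oneTo F (ℕₚ.≤-trans 1≤a (ℕₚ.m≤n+m a (k * h))) stay≤N) (descent h stay≤N) ⟩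
    F (k * h + a) ⊕ descentGF n h
      ≈⟨ +-congʳ (*-cong (partWeight-a h) (tailGF-level n h (inj₁ refl) stay≤N)) ⟩
    levelGF (suc n) h
      ∎
    where
    a≤c : a ≤ c
    a≤c = proj₁ (a≤c≤b c∈ab)
    c≤b : c ≤ b
    c≤b = proj₂ (a≤c≤b c∈ab)
    stay≤N : k * h + a ≤ N
    stay≤N = ℕₚ.≤-trans (ℕₚ.+-monoʳ-≤ (k * h) a≤c) x≤N
    F : ℕ → Carrier
    F y = partWeight y · tailGF N n y
    F-invalid : ∀ {y} → partOK k a b y ≡ false → F y ≈ 0#
    F-invalid invalid = ≈-trans (*-congˡ (tailGF-invalid N n invalid)) (zeroʳ _)
    descent : ∀ h → k * h + a ≤ N → ∑[ y ∈ oneTo N ] (if descentᵇ h y then F y else 0#) ≈ descentGF n h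
    descent zero    _      = ∑-zero (oneTo N)
    descent (suc h) stay≤N = ≈-trans (∑-δ-oneTo F 1≤descent descent≤N)
                                     (*-cong (partWeight-b h) (tailGF-level n h (inj₂ refl) descent≤N))
      where
      descent≤N : k * h + b ≤ N
      descent≤N = ℕₚ.≤-trans (ℕₚ.<⇒≤ (k*h+b<k*[1+h]+c h 1≤a)) stay≤N
      1≤descent : 1 ≤ k * h + b
      1≤descent = ℕₚ.≤-trans (ℕₚ.≤-trans 1≤a (ℕₚ.<⇒≤ a<b)) (ℕₚ.m≤n+m b (k * h))

  levelGF-closed : ∀ n h → levelGF n h ≈ monomial (n ∸ h) h (levelExponent n h) · gaussian n h
  levelGF-closed zero zero = begin
    1#                                      ≈⟨ ≈-trans (*-identityʳ _) (≈-trans (*-identityʳ _) (*-identityʳ 1#)) ⟨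
    monomial 0 0 0 · 1#                     ≈⟨ *-congʳ (≈-reflexive (cong (monomial 0 0) levelExponent-0-0)) ⟨
    monomial 0 0 (levelExponent 0 0) · 1#   ∎
  levelGF-closed zero (suc h) = ≈-sym (zeroʳ _)
  levelGF-closed (suc n) zero = begin
    monomial 1 0 (k * 0 + a) · levelGF n 0 ⊕ 0#
      ≈⟨ +-identityʳ _ ⟩
    monomial 1 0 (k * 0 + a) · levelGF n 0
      ≈⟨ *-congˡ (levelGF-closed n 0) ⟩
    monomial 1 0 (k * 0 + a) · (monomial n 0 (levelExponent n 0) · gaussian n 0)
      ≈⟨ xy≈w⇒x·yz≈w·z (stay-monomial {n} z≤n) ⟩
    monomial (suc n) 0 (levelExponent (suc n) 0) · pow q (k * 0) · gaussian n 0
      ≈⟨ *-cong (≈-trans (*-congˡ (≈-reflexive (cong (pow q) (ℕₚ.*-zeroʳ k)))) (*-identityʳ _))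
                (≈-reflexive (gaussian-n-0 n)) ⟩
    monomial (suc n) 0 (levelExponent (suc n) 0) · gaussian (suc n) 0
      ∎
  levelGF-closed (suc n) (suc h) = begin
    m₁ · levelGF n (suc h) ⊕ m₂ · levelGF n h
      ≈⟨ +-comm _ _ ⟩
    m₂ · levelGF n h ⊕ m₁ · levelGF n (suc h)
      ≈⟨ +-cong (*-congˡ (levelGF-closed n h)) (*-congˡ (levelGF-closed n (suc h))) ⟩
    m₂ · (monomial (n ∸ h) h (levelExponent n h) · gaussian n h) ⊕ m₁ · (M₁ · gaussian n (suc h))
      ≈⟨ +-cong (xy≈w⇒x·yz≈w·z (descent-monomial n h)) stayed ⟩
    M · gaussian n h ⊕ M · (θ · gaussian n (suc h))
      ≈⟨ distribˡ M _ _ ⟨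
    M · gaussian (suc n) (suc h)
      ∎
    where
    m₁ m₂ M₁ M θ : Carrier
    m₁ = monomial 1 0 (k * suc h + a)
    m₂ = monomial 0 1 (k * h + b)
    M₁ = monomial (n ∸ suc h) (suc h) (levelExponent n (suc h))
    M  = monomial (n ∸ h) (suc h) (levelExponent (suc n) (suc h))
    θ  = pow (pow q k) (suc h)
    stayed : m₁ · (M₁ · gaussian n (suc h)) ≈ M · (θ · gaussian n (suc h))
    stayed with suc h ℕₚ.≤? n
    ... | yes h<n = begin
      m₁ · (M₁ · gaussian n (suc h))              ≈⟨ xy≈w⇒x·yz≈w·z (stay-monomial h<n) ⟩
      M · pow q (k * suc h) · gaussian n (suc h)  ≈⟨ *-congʳ (*-congˡ (pow-* q k (suc h))) ⟨
      M · θ · gaussian n (suc h)                  ≈⟨ *-assoc M θ _ ⟩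
      M · (θ · gaussian n (suc h))                ∎
    ... | no h≮n = ≈-trans (vanish m₁ M₁) (≈-sym (vanish M θ))
      where
      vanish : ∀ x y → x · (y · gaussian n (suc h)) ≈ 0#
      vanish x y = ≈-trans (*-congˡ (≈-trans (*-congˡ (gaussian-vanishes (ℕₚ.≰⇒> h≮n))) (zeroʳ y))) (zeroʳ x)

  genSum-tail : ∀ n h c → 1 ≤ k * h + c →
                genSum k a b (suc n) h c u v q ≈ partWeight (k * h + c) · tailGF (k * h + c) n (k * h + c)
  genSum-tail n h c 1≤N = begin
    genSum k a b (suc n) h c u v q
      ≡⟨ foldr≡∑ weight (BRset k a b (suc n) h c) ⟩
    ∑ (BRset k a b (suc n) h c) weight
      ≈⟨ ∑-filter (λ l → isBR k a b (suc n) l ∧ (largest l ≡ᵇ N)) (lists (suc n) N) weight ⟩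
    ∑[ l ∈ lists (suc n) N ] (if isBR k a b (suc n) l ∧ (largest l ≡ᵇ N) then weight l else 0#)
      ≈⟨ ∑-lists-suc n N _ ⟩
    ∑[ y ∈ oneTo N ] ∑[ l ∈ lists n N ] (if isBR k a b (suc n) (y ∷ l) ∧ (y ≡ᵇ N) then weight (y ∷ l) else 0#)
      ≈⟨ ∑-cong (oneTo N) top ⟩
    ∑[ y ∈ oneTo N ] (if y ≡ᵇ N then partWeight y · tailGF N n y else 0#)
      ≈⟨ ∑-δ-oneTo _ 1≤N ℕₚ.≤-refl ⟩
    partWeight N · tailGF N n N
      ∎
    where
    N : ℕ
    N = k * h + c
    top : ∀ y → ∑[ l ∈ lists n N ] (if isBR k a b (suc n) (y ∷ l) ∧ (y ≡ᵇ N) then weight (y ∷ l) else 0#)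
              ≈ (if y ≡ᵇ N then partWeight y · tailGF N n y else 0#)
    top y = begin
      ∑[ l ∈ lists n N ] (if isBR k a b (suc n) (y ∷ l) ∧ (y ≡ᵇ N) then weight (y ∷ l) else 0#)
        ≈⟨ ∑-congᴬ (All.map (λ {l} → pointwise {l}) (lists-length n N)) ⟩
      ∑[ l ∈ lists n N ] (if y ≡ᵇ N then partWeight y · (if chainOK k a b (y ∷ l) then weight l else 0#) else 0#)
        ≈⟨ ∑-if (y ≡ᵇ N) (lists n N) _ ⟩
      (if y ≡ᵇ N then ∑[ l ∈ lists n N ] (partWeight y · (if chainOK k a b (y ∷ l) then weight l else 0#)) else 0#)
        ≈⟨ if-cong (y ≡ᵇ N) (∑-*ˡ (lists n N) (partWeight y) _) ⟩
      (if y ≡ᵇ N then partWeight y · tailGF N n y else 0#)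
        ∎
      where
      pointwise : ∀ {l} → length l ≡ n →
                  (if isBR k a b (suc n) (y ∷ l) ∧ (y ≡ᵇ N) then weight (y ∷ l) else 0#)
                  ≈ (if y ≡ᵇ N then partWeight y · (if chainOK k a b (y ∷ l) then weight l else 0#) else 0#)
      pointwise {l} len rewrite dec-true (length l ≟ n) len = begin
        (if chainOK k a b (y ∷ l) ∧ (y ≡ᵇ N) then weight (y ∷ l) else 0#)
          ≡⟨ ≡.trans (if-∧ (chainOK k a b (y ∷ l))) (if-swap-then (chainOK k a b (y ∷ l)) (y ≡ᵇ N)) ⟩
        (if y ≡ᵇ N then (if chainOK k a b (y ∷ l) then weight (y ∷ l) else 0#) else 0#)
          ≈⟨ if-cong (y ≡ᵇ N) (≈-trans (if-cong (chainOK k a b (y ∷ l)) (weight-∷ y l)) (if-*ˡ _ _ _)) ⟩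
        (if y ≡ᵇ N then partWeight y · (if chainOK k a b (y ∷ l) then weight l else 0#) else 0#)
          ∎

  genSum-poch : ∀ n h {c X} → c ≡ a ⊎ c ≡ b → h ≤ n →
                partWeight (k * h + c) · monomial (n ∸ h) h (levelExponent n h) ≈ X →
                genSum k a b (suc n) h c u v q · poch (pow q k) h · poch (pow q k) (n ∸ h) ≈ X · poch (pow q k) n
  genSum-poch n h {c} {X} c∈ab h≤n top = begin
    genSum k a b (suc n) h c u v q · poch (pow q k) h · poch (pow q k) (n ∸ h)
      ≈⟨ *-congʳ (*-congʳ (genSum-tail n h c 1≤N)) ⟩
    partWeight (k * h + c) · tailGF (k * h + c) n (k * h + c) · poch (pow q k) h · poch (pow q k) (n ∸ h)
      ≈⟨ *-congʳ (*-congʳ (*-congˡ (≈-trans (tailGF-level n h c∈ab ℕₚ.≤-refl) (levelGF-closed n h)))) ⟩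
    partWeight (k * h + c) · (monomial (n ∸ h) h (levelExponent n h) · gaussian n h)
      · poch (pow q k) h · poch (pow q k) (n ∸ h)
      ≈⟨ *-congʳ (*-congʳ (xy≈w⇒x·yz≈w·z top)) ⟩
    X · gaussian n h · poch (pow q k) h · poch (pow q k) (n ∸ h)
      ≈⟨ *-gaussian-poch h≤n X ⟩
    X · poch (pow q k) n
      ∎
    where
    1≤N : 1 ≤ k * h + c
    1≤N = ℕₚ.≤-trans (ℕₚ.≤-trans 1≤a (proj₁ (a≤c≤b c∈ab))) (ℕₚ.m≤n+m c (k * h))

  top-monomial-a : ∀ {n h} → h ≤ n →
    partWeight (k * h + a) · monomial (n ∸ h) h (levelExponent n h)
      ≈ monomial (suc n ∸ h) h (suc n * a + k * (suc h C 2) + (b ∸ a) * h)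
  top-monomial-a {n} {h} h≤n = begin
    partWeight (k * h + a) · monomial (n ∸ h) h (levelExponent n h)
      ≈⟨ ≈-trans (*-congʳ (partWeight-a h)) (stay-monomial h≤n) ⟩
    monomial (suc n ∸ h) h (levelExponent (suc n) h) · pow q (k * h)
      ≈⟨ monomial-*-pow (suc n ∸ h) h (levelExponent (suc n) h) (k * h) ⟩
    monomial (suc n ∸ h) h (levelExponent (suc n) h + k * h)
      ≡⟨ cong (monomial (suc n ∸ h) h) (exponent-top n h) ⟩
    monomial (suc n ∸ h) h (suc n * a + k * (suc h C 2) + (b ∸ a) * h)
      ∎

  top-monomial-b : ∀ {n h} → h ≤ n →
    partWeight (k * h + b) · monomial (n ∸ h) h (levelExponent n h)
      ≈ monomial (suc n ∸ h ∸ 1) (suc h) (suc n * a + k * (suc h C 2) + (b ∸ a) * suc h)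
  top-monomial-b {n} {h} h≤n = begin
    partWeight (k * h + b) · monomial (n ∸ h) h (levelExponent n h)
      ≈⟨ ≈-trans (*-congʳ (partWeight-b h)) (descent-monomial n h) ⟩
    monomial (n ∸ h) (suc h) (levelExponent (suc n) (suc h))
      ≡⟨ cong (λ i → monomial i (suc h) (levelExponent (suc n) (suc h))) n∸h≡1+n∸h∸1 ⟩
    monomial (suc n ∸ h ∸ 1) (suc h) (suc n * a + k * (suc h C 2) + (b ∸ a) * suc h)
      ∎
    where
    n∸h≡1+n∸h∸1 : n ∸ h ≡ suc n ∸ h ∸ 1
    n∸h≡1+n∸h∸1 = ≡.sym (≡.trans (ℕₚ.∸-+-assoc (suc n) h 1) (cong (suc n ∸_) (ℕₚ.+-comm h 1)))

mainTheorem9 : ∀ {c ℓ' : Level} (R : CommutativeRing c ℓ') →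
    let open Ring R
    in (a b k : ℕ) .{{_ : NonZero k}} → 1 ≤ a → a < b → b ≤ k →
       (m h : ℕ) → 1 ≤ m → h ≤ m ∸ 1 →
       (u v q : Carrier) →
       ((genSum k a b m h a u v q · poch (pow q k) h · poch (pow q k) (m ∸ 1 ∸ h)
          ≈ pow u (m ∸ h) · pow v h
            · pow q (m * a + k * (suc h C 2) + (b ∸ a) * h)
            · poch (pow q k) (m ∸ 1))
       ×
        (genSum k a b m h b u v q · poch (pow q k) h · poch (pow q k) (m ∸ 1 ∸ h)
          ≈ pow u (m ∸ h ∸ 1) · pow v (suc h)
            · pow q (m * a + k * (suc h C 2) + (b ∸ a) * suc h)
            · poch (pow q k) (m ∸ 1)))
mainTheorem9 R a b k 1≤a a<b b≤k zero    h ()  _   u v q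
mainTheorem9 R a b k 1≤a a<b b≤k (suc n) h _   h≤n u v q =
  genSum-poch n h (inj₁ refl) h≤n (top-monomial-a h≤n) , genSum-poch n h (inj₂ refl) h≤n (top-monomial-b h≤n)
  where open Generating R k a b 1≤a a<b b≤k u v q
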